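{- For every instance, if $\mathcal{S}$ is a schedule minimizing the maximum flow time $\max_i f_i(\mathcal{S})$, then $F(\mathcal{S})\le n\cdot F(\mathcal{OPT})$.
   Context: A single machine and $n$ jobs; job $J_i$ has integer release time $r_i\ge0$ and integer processing time $p_i\ge1$. Time is divided into unit slots $[t]=[t,t+1)$, $t\in\mathbb{N}$; a (preemptive) schedule assigns each slot to at most one job so that $J_i$ receives exactly $p_i$ slots, all with $t\ge r_i$. $c_i(\mathcal{S})$ is $1$ plus the last slot of $J_i$, $f_i(\mathcal{S})=c_i(\mathcal{S})-r_i$, $F(\mathcal{S})=\sum_i f_i(\mathcal{S})^2$, and $\mathcal{OPT}$ is a schedule minimizing $F$. -}

module Defs where

open import Data.Nat using (ℕ; zero; suc; _+_; _*_; _∸_; _≤_; _⊔_)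
open import Data.Fin using (Fin) renaming (zero to fzero; suc to fsuc)
open import Data.Fin.Properties using () renaming (_≟_ to _≟ᶠ_)
open import Data.Maybe using (Maybe; just; nothing)
open import Data.Product using (Σ; _×_; _,_; proj₁)
open import Relation.Nullary using (yes; no)
open import Relation.Binary.PropositionalEquality using (_≡_)

record Instance (n : ℕ) : Set where
  field
    r   : Fin n → ℕ
    p   : Fin n → ℕ
    p≥1 : ∀ i → 1 ≤ p i
open Instance public

-- A slot assignment: slot [t] = [t,t+1) is given to at most one job
-- (nothing = idle).  'horizon' bounds the busy slots: all slots t ≥ horizon are idle.
record Assignment (n : ℕ) : Set where
  field
    slot    : ℕ → Maybe (Fin n)
    horizon : ℕ
    idle-after : ∀ t → horizon ≤ t → slot t ≡ nothing
open Assignment public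

isJob : {n : ℕ} → Maybe (Fin n) → Fin n → ℕ
isJob nothing  i = 0
isJob (just j) i with j ≟ᶠ i
... | yes _ = 1
... | no  _ = 0

slotsBelow : {n : ℕ} → (ℕ → Maybe (Fin n)) → Fin n → ℕ → ℕ
slotsBelow σ i zero    = 0
slotsBelow σ i (suc T) = slotsBelow σ i T + isJob (σ T) i

lastPlusOne : {n : ℕ} → (ℕ → Maybe (Fin n)) → Fin n → ℕ → ℕ
lastPlusOne σ i zero    = 0
lastPlusOne σ i (suc T) with isJob (σ T) i
... | zero  = lastPlusOne σ i T
... | suc _ = suc T

record IsSchedule {n : ℕ} (I : Instance n) (S : Assignment n) : Set where
  field
    amount  : ∀ i → slotsBelow (slot S) i (horizon S) ≡ p I i
    release : ∀ i t → slot S t ≡ just i → r I i ≤ t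
open IsSchedule public

Schedule : {n : ℕ} → Instance n → Set
Schedule {n} I = Σ (Assignment n) (IsSchedule I)

completion : {n : ℕ} → Assignment n → Fin n → ℕ
completion S i = lastPlusOne (slot S) i (horizon S)

-- flow time f_i(S) = c_i(S) - r_i  (c_i > r_i for a valid schedule)
flow : {n : ℕ} → Instance n → Assignment n → Fin n → ℕ
flow I S i = completion S i ∸ r I i

sumFin : (n : ℕ) → (Fin n → ℕ) → ℕ
sumFin zero    f = 0
sumFin (suc n) f = f fzero + sumFin n (λ i → f (fsuc i))

maxFin : (n : ℕ) → (Fin n → ℕ) → ℕ
maxFin zero    f = 0
maxFin (suc n) f = f fzero ⊔ maxFin n (λ i → f (fsuc i))

totalSqFlow : {n : ℕ} → Instance n → Assignment n → ℕ
totalSqFlow {n} I S = sumFin n (λ i → flow I S i * flow I S i)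

maxFlow : {n : ℕ} → Instance n → Assignment n → ℕ
maxFlow {n} I S = maxFin n (flow I S)

MinimizesMaxFlow : {n : ℕ} → (I : Instance n) → Schedule I → Set
MinimizesMaxFlow I (S , _) = ∀ (T : Schedule I) → maxFlow I S ≤ maxFlow I (proj₁ T)

MinimizesF : {n : ℕ} → (I : Instance n) → Schedule I → Set
MinimizesF I O = ∀ (T : Schedule I) → totalSqFlow I (proj₁ O) ≤ totalSqFlow I (proj₁ T)

-- Every flow time of S is at most max f(S), so F(S) ≤ n·(max f(S))².  Since S minimizes the
-- maximum flow, max f(S) ≤ max f(OPT), and the square of the largest flow time of OPT is
-- one of the summands of F(OPT).
module Submission where

open import Defs
open import Data.Nat using (ℕ; zero; suc; _*_; _≤_; z≤n)
open import Data.Nat.Properties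
open import Data.Fin using (Fin) renaming (zero to fzero; suc to fsuc)
open import Data.Product using (∃; proj₁; _,_)
open import Data.Sum using (_⊎_; inj₁; inj₂)
open import Relation.Binary.PropositionalEquality using (_≡_; refl; trans)

≤-maxFin : (n : ℕ) (f : Fin n → ℕ) (i : Fin n) → f i ≤ maxFin n f
≤-maxFin (suc n) f fzero    = m≤m⊔n _ _
≤-maxFin (suc n) f (fsuc i) =
  ≤-trans (≤-maxFin n (λ j → f (fsuc j)) i) (m≤n⊔m (f fzero) _)

maxFin-sel : (n : ℕ) (f : Fin n → ℕ) → maxFin n f ≡ 0 ⊎ ∃ λ i → maxFin n f ≡ f i
maxFin-sel zero    f = inj₁ refl
maxFin-sel (suc n) f with ⊔-sel (f fzero) (maxFin n (λ j → f (fsuc j)))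
... | inj₁ max≡head = inj₂ (fzero , max≡head)
... | inj₂ max≡tail with maxFin-sel n (λ j → f (fsuc j))
...   | inj₁ tail≡0       = inj₁ (trans max≡tail tail≡0)
...   | inj₂ (i , tail≡i) = inj₂ (fsuc i , trans max≡tail tail≡i)

≤-sumFin : (n : ℕ) (f : Fin n → ℕ) (i : Fin n) → f i ≤ sumFin n f
≤-sumFin (suc n) f fzero    = m≤m+n _ _
≤-sumFin (suc n) f (fsuc i) = ≤-trans (≤-sumFin n (λ j → f (fsuc j)) i) (m≤n+m _ (f fzero))

sumFin-≤-* : (n : ℕ) (f : Fin n → ℕ) (c : ℕ) → (∀ i → f i ≤ c) → sumFin n f ≤ n * c
sumFin-≤-* zero    f c f≤c = z≤n
sumFin-≤-* (suc n) f c f≤c =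
  +-mono-≤ (f≤c fzero) (sumFin-≤-* n (λ j → f (fsuc j)) c (λ j → f≤c (fsuc j)))

square-mono-≤ : ∀ {a b} → a ≤ b → a * a ≤ b * b
square-mono-≤ a≤b = *-mono-≤ a≤b a≤b

sumFin-squares-≤-*-maxFin-square : (n : ℕ) (f : Fin n → ℕ) →
  sumFin n (λ i → f i * f i) ≤ n * (maxFin n f * maxFin n f)
sumFin-squares-≤-*-maxFin-square n f =
  sumFin-≤-* n _ _ (λ i → square-mono-≤ (≤-maxFin n f i))

maxFin-square-≤-sumFin-squares : (n : ℕ) (f : Fin n → ℕ) →
  maxFin n f * maxFin n f ≤ sumFin n (λ i → f i * f i)
maxFin-square-≤-sumFin-squares n f with maxFin n f | maxFin-sel n f
... | .0     | inj₁ refl      = z≤n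
... | .(f i) | inj₂ (i , refl) = ≤-sumFin n (λ j → f j * f j) i

-- The bound holds against every schedule of I.
propositionC3 : (n : ℕ) (I : Instance n) (S OPT : Schedule I) →
    MinimizesMaxFlow I S → MinimizesF I OPT →
    totalSqFlow I (proj₁ S) ≤ n * totalSqFlow I (proj₁ OPT)
propositionC3 n I (S , _) OPT S-minimizes-max _ = begin
  totalSqFlow I S                        ≤⟨ sumFin-squares-≤-*-maxFin-square n (flow I S) ⟩
  n * (maxFlow I S * maxFlow I S)        ≤⟨ *-monoʳ-≤ n (square-mono-≤ (S-minimizes-max OPT)) ⟩
  n * (maxFlow I O * maxFlow I O)        ≤⟨ *-monoʳ-≤ n (maxFin-square-≤-sumFin-squares n (flow I O)) ⟩
  n * totalSqFlow I O                    ∎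
  where
    open ≤-Reasoning
    O = proj₁ OPT
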